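{- Let $k,s$ be positive integers. For every real $\epsilon>0$ there exists an integer $n'_\epsilon$ such that for all $n\geq n'_\epsilon$ the following holds: if $\mathcal{H}\subseteq\binom{[n]}{k}$ satisfies $\nu(\mathcal{H})\leq s$ and $$|\mathcal{H}|\geq\left(\frac{s-1}{(k-1)!}+\epsilon\right)n^{k-1},$$ then $\mathcal{H}$ is the union of $s$ different trivial intersecting families.
   Context: $[n]=\{1,\dots,n\}$, $\binom{[n]}{k}$ is the family of $k$-subsets of $[n]$, and $\nu(\mathcal{H})$ is the largest number of pairwise disjoint members of $\mathcal{H}$. A family is trivial intersecting if the intersection of all its members is nonempty. "$\mathcal{H}$ is the union of $s$ different trivial intersecting families" means $\mathcal{H}=\bigcup_{i=1}^s\mathcal{G}_i$ where each $\mathcal{G}_i$ is a trivial intersecting family with common element $x_i$, the $x_i$ being distinct.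
   Formalization: The parameter ε ranges over the positive rationals instead of the positive reals. -}

module Defs where

open import Data.Nat using (ℕ; _≤_; _∸_; _^_; _!)
open import Data.Nat.Properties using (_!≢0)
open import Data.Integer using (+_)
open import Data.Rational using (ℚ; _/_; _+_; _*_)
open import Data.Fin using (Fin)
open import Data.Fin.Subset using (Subset; _∩_; Empty) renaming (_∈_ to _∈ₛ_)
open import Data.List using (List; length)
open import Data.List.Membership.Propositional using (_∈_)
open import Data.List.Relation.Unary.All using (All)
open import Data.List.Relation.Unary.AllPairs using (AllPairs)
open import Data.List.Relation.Unary.Unique.Propositional using (Unique)
open import Data.Product using (Σ; _×_; ∃)
open import Function.Bundles using (_⇔_)
open import Function.Definitions using (Injective)
open import Relation.Binary.PropositionalEquality using (_≡_)

-- A family of subsets of [n] = Fin n, represented as a duplicate-free list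
-- (duplicate-freeness is required separately where used); |H| = length H.

KUniform : {n : ℕ} → ℕ → List (Subset n) → Set
KUniform k H = All (λ F → Data.Fin.Subset.∣ F ∣ ≡ k) H

PairwiseDisjoint : {n : ℕ} → List (Subset n) → Set
PairwiseDisjoint L = AllPairs (λ F G → Empty (F ∩ G)) L

MatchingNumberAtMost : {n : ℕ} → List (Subset n) → ℕ → Set
MatchingNumberAtMost H s =
  (L : List (Subset _)) → All (_∈ H) L → Unique L → PairwiseDisjoint L → length L ≤ s

TrivialIntersectingAt : {n : ℕ} → Fin n → List (Subset n) → Set
TrivialIntersectingAt x G = All (x ∈ₛ_) G

UnionOfTrivialIntersecting : {n : ℕ} → ℕ → List (Subset n) → Set
UnionOfTrivialIntersecting {n} s H =
  Σ (Fin s → Fin n) λ x → Injective _≡_ _≡_ x ×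
    Σ (Fin s → List (Subset n)) λ G →
      ((i : Fin s) → TrivialIntersectingAt (x i) (G i)) ×
      ((F : Subset n) → (F ∈ H) ⇔ (∃ λ i → F ∈ G i))

threshold : ℕ → ℕ → ℚ → ℕ → ℚ
threshold k s ε n =
  ((+ (s ∸ 1) / ((k ∸ 1) !)) {{(k ∸ 1) !≢0}} + ε) * (+ (n ^ (k ∸ 1)) / 1)

-- Call a vertex big if its degree exceeds c·n^(k-2), where c = (k+1)(s+1) and n^(k-2) bounds
-- the number of edges through two given vertices (for k = 1 no edge contains two).  Such a
-- vertex lies in an edge avoiding any c prescribed vertices, so edges through distinct big
-- vertices can be chosen greedily, pairwise disjoint and disjoint from one further edge.  As
-- ν(H) ≤ s, there are hence at most s big vertices, and if there are exactly s then every edge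
-- meets one of them, which is the required decomposition.  With fewer than s big vertices, at
-- most (s-1)·n^(k-1)/(k-1)! edges meet them, and the others all meet the at most sk vertices of
-- a maximal matching among them, none of which is big, so there are O(n^(k-2)) of those; for
-- large n this total is below the threshold.
module Submission where

open import Defs
open import Data.Nat using (ℕ; zero; suc; _+_; _*_; _^_; _≤_; _<_; z≤n; s≤s; _!; _<?_; _≤?_; NonZero)
open import Data.Nat.Properties
open import Data.Nat.Solver using (module +-*-Solver)
open import Data.Nat.Coprimality using (Coprime)
open import Data.Integer as ℤ using (+_; -[1+_]; +<+)
import Data.Integer.Properties as ℤ
open import Data.Rational using (ℚ; mkℚ; _/_; 0ℚ; toℚᵘ)
  renaming (_<_ to _<ℚ_; _≤_ to _≤ℚ_; _+_ to _+ℚ_; _*_ to _*ℚ_)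
open import Data.Rational.Base using (*<*)
open import Data.Rational.Properties using (toℚᵘ-mono-≤; toℚᵘ-homo-+; toℚᵘ-homo-*; toℚᵘ-fromℚᵘ)
open import Data.Rational.Unnormalised using (mkℚᵘ; *≤*)
  renaming (_≤_ to _≤ᵘ_; _≃_ to _≃ᵘ_; _+_ to _+ᵘ_; _*_ to _*ᵘ_)
import Data.Rational.Unnormalised.Properties as ℚᵘ
open import Data.Bool using (Bool; true; false)
open import Data.Bool.Properties using () renaming (_≟_ to _≟ᵇ_)
open import Data.Empty using (⊥; ⊥-elim)
open import Data.Fin using (Fin; zero; suc)
open import Data.Fin.Subset using (Subset; ∣_∣; _⊆_; _∪_; _∩_; ⁅_⁆; Empty; Nonempty)
  renaming (_∈_ to _∈ₛ_; _∉_ to _∉ₛ_)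
open import Data.Fin.Subset.Properties
  using (_∈?_; p⊆q⇒∣p∣≤∣q∣; drop-∷-⊆; ∣⁅x⁆∣≡1; ∪-identityˡ; ∪-identityʳ
        ; x∈⁅y⁆⇒x≡y; x∈p∪q⁻; x∈p∩q⁺; x∈p∩q⁻)
open import Data.Vec using ([]; _∷_; here; there)
open import Data.List using (List; []; _∷_; _++_; length; filter; map; concatMap; lookup; take; allFin)
open import Data.List.Properties using (length-map; length-++; length-take)
open import Data.List.Relation.Binary.Sublist.Propositional.Properties
  using (length-mono-≤; filter-⊆) renaming (filter⁺ to filter-⊆-filter)
open import Data.List.Relation.Unary.Any as Any using (Any; here; there)
import Data.List.Relation.Unary.Any.Properties as Any
open import Data.List.Relation.Unary.All as All using (All; []; _∷_)
import Data.List.Relation.Unary.All.Properties as All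
open import Data.List.Relation.Unary.All.Properties.Core using (¬Any⇒All¬; ¬All⇒Any¬)
open import Data.List.Relation.Unary.AllPairs using ([]; _∷_)
open import Data.List.Relation.Unary.Unique.Propositional using (Unique)
import Data.List.Relation.Unary.Unique.Propositional.Properties as Unique
open import Data.List.Membership.Propositional using (_∈_; find; lose)
open import Data.List.Membership.Propositional.Properties using (∈-map⁺; ∈-filter⁻; ∈-filter⁺; ∈-lookup; ∈-allFin)
open import Data.Product using (_×_; _,_; ∃; proj₁; proj₂)
open import Data.Sum using ([_,_]′)
open import Function using (_∘_)
open import Function.Bundles using (mk⇔)
open import Relation.Nullary using (¬_; yes; no)
open import Relation.Unary using (Decidable)
open import Relation.Unary.Properties using (∁?)
open import Relation.Binary.PropositionalEquality
  using (_≡_; _≢_; refl; sym; trans; cong; cong₂; subst; subst₂; module ≡-Reasoning)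

private variable n : ℕ

-- Counting sets that contain a fixed set

tailsWith : Bool → List (Subset (suc n)) → List (Subset n)
tailsWith b [] = []
tailsWith b ((c ∷ F) ∷ L) with b ≟ᵇ c
... | yes _ = F ∷ tailsWith b L
... | no _  = tailsWith b L

length-tailsWith : (L : List (Subset (suc n))) →
  length L ≡ length (tailsWith true L) + length (tailsWith false L)
length-tailsWith [] = refl
length-tailsWith ((true ∷ F) ∷ L) = cong suc (length-tailsWith L)
length-tailsWith ((false ∷ F) ∷ L) = trans (cong suc (length-tailsWith L)) (sym (+-suc _ _))

All-tailsWith : ∀ {P : Subset (suc n) → Set} b {L} → All P L → All (λ F → P (b ∷ F)) (tailsWith b L)
All-tailsWith b {[]} [] = []
All-tailsWith b {(c ∷ F) ∷ L} (p ∷ ps) with b ≟ᵇ c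
... | yes refl = p ∷ All-tailsWith b ps
... | no _     = All-tailsWith b ps

Unique-tailsWith : ∀ b {L : List (Subset (suc n))} → Unique L → Unique (tailsWith b L)
Unique-tailsWith b {[]} [] = []
Unique-tailsWith b {(c ∷ F) ∷ L} (F∉L ∷ L-unique) with b ≟ᵇ c
... | yes refl = All.map (λ bF≢ F≡G → bF≢ (cong (b ∷_) F≡G)) (All-tailsWith b F∉L) ∷ Unique-tailsWith b L-unique
... | no _     = Unique-tailsWith b L-unique

All-⊥⇒length≡0 : ∀ {A : Set} {P : A → Set} {L : List A} → (∀ {x} → ¬ P x) → All P L → length L ≡ 0
All-⊥⇒length≡0 ¬P [] = refl
All-⊥⇒length≡0 ¬P (p ∷ _) = ⊥-elim (¬P p)

[1+m]*n^m+n^[1+m]≤[1+n]^[1+m] : ∀ m n → suc m * n ^ m + n ^ suc m ≤ suc n ^ suc m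
[1+m]*n^m+n^[1+m]≤[1+n]^[1+m] zero n =
  ≤-reflexive (solve 1 (λ n → con 1 :* con 1 :+ n :* con 1 := (con 1 :+ n) :* con 1) refl n)
  where open +-*-Solver
[1+m]*n^m+n^[1+m]≤[1+n]^[1+m] (suc m) n = begin
    suc (suc m) * n ^ suc m + n ^ suc (suc m)
      ≤⟨ m≤n+m _ (n ^ m + m * n ^ m) ⟩
    (n ^ m + m * n ^ m) + (suc (suc m) * n ^ suc m + n ^ suc (suc m))
      ≡⟨ solve 3 (λ n a m → (a :+ m :* a) :+ ((con 2 :+ m) :* (n :* a) :+ n :* (n :* a))
                         := (con 1 :+ n) :* ((con 1 :+ m) :* a :+ n :* a)) refl n (n ^ m) m ⟩
    suc n * (suc m * n ^ m + n ^ suc m)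
      ≤⟨ *-monoʳ-≤ (suc n) ([1+m]*n^m+n^[1+m]≤[1+n]^[1+m] m n) ⟩
    suc n * suc n ^ suc m ∎
  where open ≤-Reasoning; open +-*-Solver

Extends : ℕ → Subset n → Subset n → Set
Extends m A F = A ⊆ F × ∣ F ∣ ≡ m + ∣ A ∣

extensions-count : ∀ m (A : Subset n) {L : List (Subset n)} →
  Unique L → All (Extends m A) L → m ! * length L ≤ n ^ m
extensions-count zero [] {[]} _ _ = z≤n
extensions-count zero [] {[] ∷ []} _ _ = ≤-refl
extensions-count zero [] {[] ∷ [] ∷ _} ((≢[] ∷ _) ∷ _) _ = ⊥-elim (≢[] refl)
extensions-count (suc m) [] {[]} _ _ = ≤-reflexive (*-zeroʳ (suc m !))
extensions-count (suc m) [] {[] ∷ _} _ ((_ , ()) ∷ _)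
extensions-count {suc n} m (true ∷ A) {L} L-unique ext = begin
    m ! * length L   ≡⟨ cong (m ! *_) (trans (length-tailsWith L) (trans (cong (_+_ (length Ts)) no-false) (+-identityʳ _))) ⟩
    m ! * length Ts  ≤⟨ extensions-count m A (Unique-tailsWith true L-unique) (All.map drop-head (All-tailsWith true ext)) ⟩
    n ^ m            ≤⟨ ^-monoˡ-≤ m (n≤1+n n) ⟩
    suc n ^ m        ∎
  where
  open ≤-Reasoning
  Ts = tailsWith true L
  drop-head : ∀ {F} → Extends m (true ∷ A) (true ∷ F) → Extends m A F
  drop-head (A⊆F , ∣F∣) = drop-∷-⊆ A⊆F , suc-injective (trans ∣F∣ (+-suc m _))
  no-false : length (tailsWith false L) ≡ 0
  no-false = All-⊥⇒length≡0 (λ { (A⊆F , _) → zero∉ (A⊆F here) }) (All-tailsWith false ext)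
    where zero∉ : ∀ {F : Subset n} → ¬ (zero ∈ₛ false ∷ F)
          zero∉ ()
extensions-count {suc n} zero (false ∷ A) {L} L-unique ext = begin
    length L + 0   ≡⟨ cong (_+ 0) (trans (length-tailsWith L) (cong (_+ length Fs) no-true)) ⟩
    length Fs + 0  ≤⟨ extensions-count zero A (Unique-tailsWith false L-unique) (All.map drop-head (All-tailsWith false ext)) ⟩
    1              ∎
  where
  open ≤-Reasoning
  Fs = tailsWith false L
  drop-head : ∀ {F} → Extends zero (false ∷ A) (false ∷ F) → Extends zero A F
  drop-head (A⊆F , ∣F∣) = drop-∷-⊆ A⊆F , ∣F∣
  no-true : length (tailsWith true L) ≡ 0
  no-true = All-⊥⇒length≡0 (λ (A⊆F , ∣F∣) → <⇒≱ (≤-reflexive ∣F∣) (p⊆q⇒∣p∣≤∣q∣ (drop-∷-⊆ A⊆F)))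
                            (All-tailsWith true ext)
extensions-count {suc n} (suc m) (false ∷ A) {L} L-unique ext = begin
    suc m ! * length L
      ≡⟨ cong (suc m ! *_) (length-tailsWith L) ⟩
    suc m ! * (length Ts + length Fs)
      ≡⟨ solve 4 (λ a b t f → (a :* b) :* (t :+ f) := a :* (b :* t) :+ (a :* b) :* f) refl (suc m) (m !) (length Ts) (length Fs) ⟩
    suc m * (m ! * length Ts) + suc m ! * length Fs
      ≤⟨ +-mono-≤ (*-monoʳ-≤ (suc m) (extensions-count m A (Unique-tailsWith true L-unique)
                                                         (All.map drop-true (All-tailsWith true ext))))
                  (extensions-count (suc m) A (Unique-tailsWith false L-unique)
                                    (All.map drop-false (All-tailsWith false ext))) ⟩
    suc m * n ^ m + n ^ suc m
      ≤⟨ [1+m]*n^m+n^[1+m]≤[1+n]^[1+m] m n ⟩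
    suc n ^ suc m ∎
  where
  open ≤-Reasoning; open +-*-Solver
  Ts = tailsWith true L
  Fs = tailsWith false L
  drop-true : ∀ {F} → Extends (suc m) (false ∷ A) (true ∷ F) → Extends m A F
  drop-true (A⊆F , ∣F∣) = drop-∷-⊆ A⊆F , suc-injective ∣F∣
  drop-false : ∀ {F} → Extends (suc m) (false ∷ A) (false ∷ F) → Extends (suc m) A F
  drop-false (A⊆F , ∣F∣) = drop-∷-⊆ A⊆F , ∣F∣

-- Degrees and the union bound

star : Fin n → List (Subset n) → List (Subset n)
star x L = filter (x ∈?_) L

degree : Fin n → List (Subset n) → ℕ
degree x L = length (star x L)

Meets : List (Fin n) → Subset n → Set
Meets W F = Any (_∈ₛ F) W

Avoids : List (Fin n) → Subset n → Set
Avoids W F = All (_∉ₛ F) W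

meets? : (W : List (Fin n)) → Decidable (Meets W)
meets? W F = Any.any? (_∈? F) W

degree-filter≤ : ∀ {P : Subset n → Set} (P? : Decidable P) x L → degree x (filter P? L) ≤ degree x L
degree-filter≤ P? x L = length-mono-≤ (filter-⊆-filter (x ∈?_) (x ∈?_) (λ { refl x∈F → x∈F }) (filter-⊆ P? L))

length-filter+filter-∁ : ∀ {A : Set} {P : A → Set} (P? : Decidable P) L →
  length L ≡ length (filter P? L) + length (filter (∁? P?) L)
length-filter+filter-∁ P? [] = refl
length-filter+filter-∁ P? (x ∷ L) with P? x
... | yes _ = cong suc (length-filter+filter-∁ P? L)
... | no _  = trans (cong suc (length-filter+filter-∁ P? L)) (sym (+-suc _ _))

union-bound : ∀ f P (W : List (Fin n)) L →
  All (λ w → f * degree w L ≤ P) W → All (Meets W) L → f * length L ≤ length W * P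
union-bound f P [] [] [] [] = ≤-reflexive (*-zeroʳ f)
union-bound f P (w ∷ W) L (deg-w ∷ deg-W) covered = begin
    f * length L                       ≡⟨ cong (f *_) (length-filter+filter-∁ (w ∈?_) L) ⟩
    f * (degree w L + length L∌w)      ≡⟨ *-distribˡ-+ f (degree w L) _ ⟩
    f * degree w L + f * length L∌w    ≤⟨ +-mono-≤ deg-w (union-bound f P W L∌w deg-W′ covered′) ⟩
    P + length W * P                   ∎
  where
  open ≤-Reasoning
  L∌w = filter (∁? (w ∈?_)) L
  deg-W′ : All (λ v → f * degree v L∌w ≤ P) W
  deg-W′ = All.map (≤-trans (*-monoʳ-≤ f (degree-filter≤ (∁? (w ∈?_)) _ L))) deg-W
  covered′ : All (Meets W) L∌w
  covered′ = All.zipWith (λ { (here w∈F , w∉F) → ⊥-elim (w∉F w∈F) ; (there W-meets , _) → W-meets })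
                         (All.filter⁺ (∁? (w ∈?_)) covered , All.all-filter (∁? (w ∈?_)) L)

x∈p⇒⁅x⁆⊆p : ∀ {x : Fin n} {p} → x ∈ₛ p → ⁅ x ⁆ ⊆ p
x∈p⇒⁅x⁆⊆p {p = p} x∈p y∈⁅x⁆ = subst (_∈ₛ p) (sym (x∈⁅y⁆⇒x≡y _ y∈⁅x⁆)) x∈p

x,y∈p⇒⁅x⁆∪⁅y⁆⊆p : ∀ {x y : Fin n} {p} → x ∈ₛ p → y ∈ₛ p → ⁅ x ⁆ ∪ ⁅ y ⁆ ⊆ p
x,y∈p⇒⁅x⁆∪⁅y⁆⊆p {x = x} {y} x∈p y∈p z∈ = [ x∈p⇒⁅x⁆⊆p x∈p , x∈p⇒⁅x⁆⊆p y∈p ]′ (x∈p∪q⁻ ⁅ x ⁆ ⁅ y ⁆ z∈)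

x≢y⇒∣⁅x⁆∪⁅y⁆∣≡2 : {x y : Fin n} → x ≢ y → ∣ ⁅ x ⁆ ∪ ⁅ y ⁆ ∣ ≡ 2
x≢y⇒∣⁅x⁆∪⁅y⁆∣≡2 {x = zero}  {zero}  x≢y = ⊥-elim (x≢y refl)
x≢y⇒∣⁅x⁆∪⁅y⁆∣≡2 {x = zero}  {suc y} _   = cong suc (trans (cong ∣_∣ (∪-identityˡ ⁅ y ⁆)) (∣⁅x⁆∣≡1 y))
x≢y⇒∣⁅x⁆∪⁅y⁆∣≡2 {x = suc x} {zero}  _   = cong suc (trans (cong ∣_∣ (∪-identityʳ ⁅ x ⁆)) (∣⁅x⁆∣≡1 x))
x≢y⇒∣⁅x⁆∪⁅y⁆∣≡2 {x = suc x} {suc y} x≢y = x≢y⇒∣⁅x⁆∪⁅y⁆∣≡2 (x≢y ∘ cong suc)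

degree-bound : ∀ k1 {L : List (Subset n)} → Unique L → KUniform (suc k1) L →
  ∀ x → k1 ! * degree x L ≤ n ^ k1
degree-bound k1 {L} L-unique uniform x = extensions-count k1 ⁅ x ⁆ (Unique.filter⁺ (x ∈?_) L-unique)
  (All.zipWith extends (All.all-filter (x ∈?_) L , All.filter⁺ (x ∈?_) uniform))
  where
  extends : ∀ {F} → x ∈ₛ F × ∣ F ∣ ≡ suc k1 → Extends k1 ⁅ x ⁆ F
  extends (x∈F , ∣F∣) = x∈p⇒⁅x⁆⊆p x∈F , trans ∣F∣ (trans (+-comm 1 k1) (cong (_+_ k1) (sym (∣⁅x⁆∣≡1 x))))

codegreeBound : ℕ → ℕ → ℕ
codegreeBound zero    n = 0
codegreeBound (suc j) n = n ^ j

star-⊇pair : ∀ {k} {x w : Fin n} L → All (x ∈ₛ_) L → KUniform k L →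
  All (λ F → ⁅ x ⁆ ∪ ⁅ w ⁆ ⊆ F × ∣ F ∣ ≡ k) (star w L)
star-⊇pair {w = w} L ∋x uniform =
  All.zipWith (λ ((x∈F , ∣F∣) , w∈F) → (λ {_} → x,y∈p⇒⁅x⁆∪⁅y⁆⊆p x∈F w∈F) , ∣F∣)
              (All.filter⁺ (w ∈?_) (All.zip (∋x , uniform)) , All.all-filter (w ∈?_) L)

codegree-bound : ∀ k1 {L : List (Subset n)} → Unique L → KUniform (suc k1) L →
  ∀ {x w} → x ≢ w → All (x ∈ₛ_) L → degree w L ≤ codegreeBound k1 n
codegree-bound zero {L} _ uniform {x} {w} x≢w ∋x =
  ≤-reflexive (All-⊥⇒length≡0 pair⊈singleton (star-⊇pair L ∋x uniform))
  where
  pair⊈singleton : ∀ {F} → ¬ (⁅ x ⁆ ∪ ⁅ w ⁆ ⊆ F × ∣ F ∣ ≡ 1)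
  pair⊈singleton (pair⊆F , ∣F∣) =
    <⇒≱ (s≤s (s≤s z≤n)) (subst₂ _≤_ (x≢y⇒∣⁅x⁆∪⁅y⁆∣≡2 x≢w) ∣F∣ (p⊆q⇒∣p∣≤∣q∣ pair⊆F))
codegree-bound {n} (suc j) {L} L-unique uniform {x} {w} x≢w ∋x = begin
    degree w L        ≤⟨ m≤n*m (degree w L) (j !) {{j !≢0}} ⟩
    j ! * degree w L  ≤⟨ extensions-count j (⁅ x ⁆ ∪ ⁅ w ⁆) (Unique.filter⁺ (w ∈?_) L-unique)
                           (All.map extends (star-⊇pair L ∋x uniform)) ⟩
    n ^ j             ∎
  where
  open ≤-Reasoning
  extends : ∀ {F} → ⁅ x ⁆ ∪ ⁅ w ⁆ ⊆ F × ∣ F ∣ ≡ suc (suc j) → Extends j (⁅ x ⁆ ∪ ⁅ w ⁆) F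
  extends (pair⊆F , ∣F∣) = pair⊆F , trans ∣F∣ (trans (+-comm 2 j) (cong (_+_ j) (sym (x≢y⇒∣⁅x⁆∪⁅y⁆∣≡2 x≢w))))

-- Matchings

elements : Subset n → List (Fin n)
elements [] = []
elements (true ∷ p) = zero ∷ map suc (elements p)
elements (false ∷ p) = map suc (elements p)

length-elements : (p : Subset n) → length (elements p) ≡ ∣ p ∣
length-elements [] = refl
length-elements (true ∷ p) = cong suc (trans (length-map suc (elements p)) (length-elements p))
length-elements (false ∷ p) = trans (length-map suc (elements p)) (length-elements p)

∈⇒∈-elements : ∀ {x} {p : Subset n} → x ∈ₛ p → x ∈ elements p
∈⇒∈-elements {p = true ∷ p} here = here refl
∈⇒∈-elements {p = true ∷ p} (there x∈p) = there (∈-map⁺ suc (∈⇒∈-elements x∈p))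
∈⇒∈-elements {p = false ∷ p} (there x∈p) = ∈-map⁺ suc (∈⇒∈-elements x∈p)

elements-∈ : (p : Subset n) → All (_∈ₛ p) (elements p)
elements-∈ [] = []
elements-∈ (true ∷ p) = here ∷ All.map⁺ (All.map there (elements-∈ p))
elements-∈ (false ∷ p) = All.map⁺ (All.map there (elements-∈ p))

∉⇒All≢-elements : ∀ {x} {p : Subset n} → x ∉ₛ p → All (x ≢_) (elements p)
∉⇒All≢-elements {p = p} x∉p = All.map (λ y∈p x≡y → x∉p (subst (_∈ₛ p) (sym x≡y) y∈p)) (elements-∈ p)

Avoids-elements⇒Empty[p∩q] : {p q : Subset n} → Avoids (elements p) q → Empty (p ∩ q)
Avoids-elements⇒Empty[p∩q] {p = p} {q} q-avoids (x , x∈p∩q) with x∈p∩q⁻ p q x∈p∩q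
... | x∈p , x∈q = All.lookup q-avoids (∈⇒∈-elements x∈p) x∈q

Avoids-elements⇒Empty[q∩p] : {p q : Subset n} → Avoids (elements p) q → Empty (q ∩ p)
Avoids-elements⇒Empty[q∩p] {p = p} {q} q-avoids (x , x∈q∩p) with x∈p∩q⁻ q p x∈q∩p
... | x∈q , x∈p = All.lookup q-avoids (∈⇒∈-elements x∈p) x∈q

Nonempty⇒Meets-elements : {p : Subset n} → Nonempty p → Meets (elements p) p
Nonempty⇒Meets-elements (x , x∈p) = Any.map (λ { refl → x∈p }) (∈⇒∈-elements x∈p)

∣p∣≡1+m⇒Nonempty : ∀ {m} (p : Subset n) → ∣ p ∣ ≡ suc m → Nonempty p
∣p∣≡1+m⇒Nonempty (true ∷ p) _ = zero , here
∣p∣≡1+m⇒Nonempty (false ∷ p) ∣p∣ with ∣p∣≡1+m⇒Nonempty p ∣p∣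
... | x , x∈p = suc x , there x∈p

PairwiseDisjoint⇒Unique : {M : List (Subset n)} → PairwiseDisjoint M → All Nonempty M → Unique M
PairwiseDisjoint⇒Unique [] [] = []
PairwiseDisjoint⇒Unique (F-disjoint ∷ disjoint) ((x , x∈F) ∷ nonempty) =
  All.map (λ F∩G=∅ F≡G → F∩G=∅ (x , x∈p∩q⁺ (x∈F , subst (x ∈ₛ_) F≡G x∈F))) F-disjoint
  ∷ PairwiseDisjoint⇒Unique disjoint nonempty

length≤s : ∀ {k1 s} {H M : List (Subset n)} → MatchingNumberAtMost H s → KUniform (suc k1) H →
  All (_∈ H) M → PairwiseDisjoint M → length M ≤ s
length≤s ν≤s uniform M⊆H disjoint =
  ν≤s _ M⊆H (PairwiseDisjoint⇒Unique disjoint (All.map (∣p∣≡1+m⇒Nonempty _ ∘ All.lookup uniform) M⊆H)) disjoint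

length-concatMap-elements : ∀ {k} (M : List (Subset n)) → KUniform k M → length (concatMap elements M) ≡ length M * k
length-concatMap-elements [] [] = refl
length-concatMap-elements (F ∷ M) (∣F∣ ∷ uniform) =
  trans (length-++ (elements F)) (cong₂ _+_ (trans (length-elements F) ∣F∣) (length-concatMap-elements M uniform))

maximal-matching : (L : List (Subset n)) → All Nonempty L →
  ∃ λ M → All (_∈ L) M × PairwiseDisjoint M × All (Meets (concatMap elements M)) L
maximal-matching [] [] = [] , [] , [] , []
maximal-matching (F ∷ L) (F≠∅ ∷ L≠∅) with maximal-matching L L≠∅
... | M , M⊆L , disjoint , covered with meets? (concatMap elements M) F
...   | yes F-meets = M , All.map there M⊆L , disjoint , F-meets ∷ covered
...   | no ¬F-meets =
        F ∷ M , here refl ∷ All.map there M⊆L ,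
        All.map Avoids-elements⇒Empty[q∩p] (All.map⁻ (All.concat⁻ (¬Any⇒All¬ _ ¬F-meets))) ∷ disjoint ,
        Any.++⁺ˡ (Nonempty⇒Meets-elements F≠∅) ∷ All.map (Any.++⁺ʳ (elements F)) covered

-- Big vertices

budget-split : ∀ k1 w m {c} → w + suc (suc k1) * suc m ≤ c → w + m ≤ c
budget-split k1 w m = ≤-trans (+-monoʳ-≤ w (≤-trans (n≤1+n m) (m≤n*m (suc m) (suc (suc k1)))))

budget-shift : ∀ k1 w m {c} → w + suc (suc k1) * suc m ≤ c → (suc k1 + w) + suc (suc k1) * m ≤ c
budget-shift k1 w m = ≤-trans (≤-trans (n≤1+n _) (≤-reflexive
  (solve 3 (λ k w m → con 1 :+ ((con 1 :+ k) :+ w) :+ (con 2 :+ k) :* m := w :+ (con 2 :+ k) :* (con 1 :+ m)) refl k1 w m)))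
  where open +-*-Solver

module Greedy {k1 : ℕ} (H : List (Subset n)) (H-unique : Unique H) (uniform : KUniform (suc k1) H) (c : ℕ) where

  bigDegree : ℕ
  bigDegree = c * codegreeBound k1 n

  Big : Fin n → Set
  Big x = bigDegree < degree x H

  length-elements-edge : ∀ {e} → e ∈ H → length (elements e) ≡ suc k1
  length-elements-edge {e} e∈H = trans (length-elements e) (All.lookup uniform e∈H)

  edge-through-avoiding : ∀ {b} (W : List (Fin n)) → Big b → length W ≤ c → All (b ≢_) W →
    ∃ λ e → e ∈ H × b ∈ₛ e × Avoids W e
  edge-through-avoiding {b} W big |W|≤c b∉W with All.all? (meets? W) (star b H)
  ... | yes all-meet = ⊥-elim (<⇒≱ big (begin
          degree b H              ≡⟨ *-identityˡ _ ⟨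
          1 * length (star b H)   ≤⟨ union-bound 1 P W (star b H) codegrees all-meet ⟩
          length W * P            ≤⟨ *-monoˡ-≤ P |W|≤c ⟩
          bigDegree               ∎))
    where
    open ≤-Reasoning
    P = codegreeBound k1 n
    codegrees : All (λ w → 1 * degree w (star b H) ≤ P) W
    codegrees = All.map (λ b≢w → ≤-trans (≤-reflexive (*-identityˡ _))
      (codegree-bound k1 (Unique.filter⁺ (b ∈?_) H-unique) (All.filter⁺ (b ∈?_) uniform) b≢w (All.all-filter (b ∈?_) H))) b∉W
  ... | no ¬all-meet with find (¬All⇒Any¬ (meets? W) (star b H) ¬all-meet)
  ...   | e , e∈star , ¬e-meets with ∈-filter⁻ (b ∈?_) {xs = H} e∈star
  ...     | e∈H , b∈e = e , e∈H , b∈e , ¬Any⇒All¬ W ¬e-meets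

  record AvoidingMatching (W : List (Fin n)) (m : ℕ) : Set where
    field
      edges    : List (Subset n)
      size     : length edges ≡ m
      ⊆H       : All (_∈ H) edges
      disjoint : PairwiseDisjoint edges
      avoids   : All (Avoids W) edges

  -- The edge for b must avoid W and the big vertices bs still to be served;
  -- the budget reserves k + 1 places per big vertex: itself, then the k vertices of its edge.
  greedy-matching : (bs W : List (Fin n)) → All Big bs → Unique bs → All (λ b → All (b ≢_) W) bs →
    length W + suc (suc k1) * length bs ≤ c → AvoidingMatching W (length bs)
  greedy-matching [] W _ _ _ _ = record { edges = [] ; size = refl ; ⊆H = [] ; disjoint = [] ; avoids = [] }
  greedy-matching (b ∷ bs) W (big ∷ bigs) (b∉bs ∷ bs-unique) (b∉W ∷ bs∉W) fits
    with edge-through-avoiding (W ++ bs) big (subst (_≤ c) (sym (length-++ W)) (budget-split k1 (length W) (length bs) fits))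
                               (All.++⁺ b∉W b∉bs)
  ... | e , e∈H , b∈e , e-avoids = record
    { edges    = e ∷ edges
    ; size     = cong suc size
    ; ⊆H       = e∈H ∷ ⊆H
    ; disjoint = All.map (Avoids-elements⇒Empty[p∩q] ∘ All.++⁻ˡ (elements e)) avoids ∷ disjoint
    ; avoids   = All.++⁻ˡ W e-avoids ∷ All.map (All.++⁻ʳ (elements e)) avoids
    }
    where
    fits′ : length (elements e ++ W) + suc (suc k1) * length bs ≤ c
    fits′ = subst (λ l → l + _ ≤ c)
      (sym (trans (length-++ (elements e)) (cong (_+ length W) (length-elements-edge e∈H))))
      (budget-shift k1 (length W) (length bs) fits)
    bs∉e++W : All (λ b′ → All (b′ ≢_) (elements e ++ W)) bs
    bs∉e++W = All.zipWith (λ (b′∉e , b′∉W) → All.++⁺ (∉⇒All≢-elements b′∉e) b′∉W) (All.++⁻ʳ W e-avoids , bs∉W)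
    open AvoidingMatching (greedy-matching bs (elements e ++ W) bigs bs-unique bs∉e++W fits′)

budget : ℕ → ℕ → ℕ
budget k1 s1 = suc (suc k1) * suc (suc s1)

module BigVertices {k1 s1 : ℕ} (H : List (Subset n)) (H-unique : Unique H) (uniform : KUniform (suc k1) H)
                   (ν≤s : MatchingNumberAtMost H (suc s1)) where

  open Greedy H H-unique uniform (budget k1 s1)

  big? : Decidable Big
  big? x = _ <? _

  B : List (Fin n)
  B = filter big? (allFin n)

  B-unique : Unique B
  B-unique = Unique.filter⁺ big? (Unique.allFin⁺ n)

  B-big : All Big B
  B-big = All.all-filter big? (allFin n)

  matching-too-large : AvoidingMatching [] (suc (suc s1)) → ⊥
  matching-too-large M = 1+n≰n (subst (_≤ suc s1) size (length≤s ν≤s uniform ⊆H disjoint))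
    where open AvoidingMatching M

  length-B≤s : length B ≤ suc s1
  length-B≤s with length B ≤? suc s1
  ... | yes |B|≤s = |B|≤s
  ... | no |B|≰s = ⊥-elim (matching-too-large (subst (AvoidingMatching []) |take|≡s+1 M))
    where
    |take|≡s+1 : length (take (suc (suc s1)) B) ≡ suc (suc s1)
    |take|≡s+1 = trans (length-take (suc (suc s1)) B) (m≤n⇒m⊓n≡m (≰⇒> |B|≰s))
    M = greedy-matching (take (suc (suc s1)) B) [] (All.take⁺ _ B-big) (Unique.take⁺ _ B-unique)
          (All.universal (λ _ → []) _) (≤-reflexive (cong (suc (suc k1) *_) |take|≡s+1))

  length-B≡s⇒covered : length B ≡ suc s1 → All (Meets B) H
  length-B≡s⇒covered |B|≡s with All.all? (meets? B) H
  ... | yes covered = covered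
  ... | no ¬covered with find (¬All⇒Any¬ (meets? B) H ¬covered)
  ...   | e , e∈H , ¬e-meets = ⊥-elim (matching-too-large (record
          { edges    = e ∷ edges
          ; size     = cong suc (trans size |B|≡s)
          ; ⊆H       = e∈H ∷ ⊆H
          ; disjoint = All.map Avoids-elements⇒Empty[p∩q] avoids ∷ disjoint
          ; avoids   = All.universal (λ _ → []) (e ∷ edges)
          }))
    where
    fits : length (elements e) + suc (suc k1) * length B ≤ budget k1 s1
    fits = begin
      length (elements e) + suc (suc k1) * length B  ≡⟨ cong₂ (λ k m → k + suc (suc k1) * m) (length-elements-edge e∈H) |B|≡s ⟩
      suc k1 + suc (suc k1) * suc s1                 ≤⟨ +-monoˡ-≤ (suc (suc k1) * suc s1) (n≤1+n (suc k1)) ⟩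
      suc (suc k1) + suc (suc k1) * suc s1           ≡⟨ *-suc (suc (suc k1)) (suc s1) ⟨
      budget k1 s1                                   ∎
      where open ≤-Reasoning
    B∉e : All (λ b → All (b ≢_) (elements e)) B
    B∉e = All.map ∉⇒All≢-elements (¬Any⇒All¬ B ¬e-meets)
    open AvoidingMatching (greedy-matching B (elements e) B-big B-unique B∉e fits)

  H-avoiding : List (Subset n)
  H-avoiding = filter (∁? (meets? B)) H

  H-avoiding⊆H : ∀ {G} → G ∈ H-avoiding → G ∈ H
  H-avoiding⊆H = proj₁ ∘ ∈-filter⁻ (∁? (meets? B)) {xs = H}

  avoiding⇒¬Big : ∀ {G w} → G ∈ H-avoiding → w ∈ₛ G → ¬ Big w
  avoiding⇒¬Big G∈ w∈G big =
    proj₂ (∈-filter⁻ (∁? (meets? B)) {xs = H} G∈) (lose (∈-filter⁺ big? (∈-allFin _) big) w∈G)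

  light : ∀ {G w} → G ∈ H-avoiding → w ∈ₛ G → 1 * degree w H-avoiding ≤ bigDegree
  light {w = w} G∈ w∈G = begin
    1 * degree w H-avoiding  ≡⟨ *-identityˡ _ ⟩
    degree w H-avoiding      ≤⟨ degree-filter≤ (∁? (meets? B)) w H ⟩
    degree w H               ≤⟨ ≮⇒≥ (avoiding⇒¬Big G∈ w∈G) ⟩
    bigDegree                ∎
    where open ≤-Reasoning

  length-H-avoiding≤ : length H-avoiding ≤ (suc s1 * suc k1 * budget k1 s1) * codegreeBound k1 n
  length-H-avoiding≤ with maximal-matching H-avoiding (All.filter⁺ (∁? (meets? B)) (All.map (∣p∣≡1+m⇒Nonempty _) uniform))
  ... | M , M⊆ , disjoint , covered = begin
    length H-avoiding                 ≡⟨ *-identityˡ _ ⟨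
    1 * length H-avoiding             ≤⟨ union-bound 1 bigDegree V H-avoiding V-light covered ⟩
    length V * bigDegree              ≡⟨ cong (_* bigDegree) length-V ⟩
    length M * suc k1 * bigDegree     ≤⟨ *-monoˡ-≤ bigDegree (*-monoˡ-≤ (suc k1) length-M≤s) ⟩
    suc s1 * suc k1 * bigDegree       ≡⟨ *-assoc (suc s1 * suc k1) (budget k1 s1) (codegreeBound k1 n) ⟨
    (suc s1 * suc k1 * budget k1 s1) * codegreeBound k1 n ∎
    where
    open ≤-Reasoning
    V = concatMap elements M
    V-light : All (λ w → 1 * degree w H-avoiding ≤ bigDegree) V
    V-light = All.concat⁺ (All.map⁺ (All.map (λ {G} G∈ → All.map (light G∈) (elements-∈ G)) M⊆))
    length-V : length V ≡ length M * suc k1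
    length-V = length-concatMap-elements M (All.map (All.lookup uniform ∘ H-avoiding⊆H) M⊆)
    length-M≤s : length M ≤ suc s1
    length-M≤s = length≤s ν≤s uniform (All.map H-avoiding⊆H M⊆) disjoint

  length-B<s⇒sparse : length B < suc s1 →
    k1 ! * length H ≤ s1 * n ^ k1 + k1 ! * ((suc s1 * suc k1 * budget k1 s1) * codegreeBound k1 n)
  length-B<s⇒sparse |B|<s = begin
      f * length H                                  ≡⟨ cong (f *_) (length-filter+filter-∁ (meets? B) H) ⟩
      f * (length H-meeting + length H-avoiding)    ≡⟨ *-distribˡ-+ f (length H-meeting) _ ⟩
      f * length H-meeting + f * length H-avoiding  ≤⟨ +-mono-≤ f*length-H-meeting≤ (*-monoʳ-≤ f length-H-avoiding≤) ⟩
      s1 * n ^ k1 + f * _                           ∎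
    where
    open ≤-Reasoning
    f = k1 !
    H-meeting = filter (meets? B) H
    f*length-H-meeting≤ : f * length H-meeting ≤ s1 * n ^ k1
    f*length-H-meeting≤ = ≤-trans
      (union-bound f (n ^ k1) B H-meeting
        (All.universal (λ x → ≤-trans (*-monoʳ-≤ f (degree-filter≤ (meets? B) x H)) (degree-bound k1 H-unique uniform x)) B)
        (All.all-filter (meets? B) H))
      (*-monoˡ-≤ (n ^ k1) (≤-pred |B|<s))

lookup-injective : ∀ {A : Set} {xs : List A} → Unique xs → ∀ {i j} → lookup xs i ≡ lookup xs j → i ≡ j
lookup-injective (_ ∷ _) {zero} {zero} _ = refl
lookup-injective (x∉xs ∷ _) {zero} {suc j} x≡ = ⊥-elim (All.lookup x∉xs (∈-lookup j) x≡)
lookup-injective (x∉xs ∷ _) {suc i} {zero} ≡x = ⊥-elim (All.lookup x∉xs (∈-lookup i) (sym ≡x))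
lookup-injective (_ ∷ xs-unique) {suc i} {suc j} eq = cong suc (lookup-injective xs-unique eq)

covered⇒UnionOfTrivialIntersecting : (H : List (Subset n)) {B : List (Fin n)} → Unique B → All (Meets B) H →
  UnionOfTrivialIntersecting (length B) H
covered⇒UnionOfTrivialIntersecting H {B} B-unique covered =
  lookup B , lookup-injective B-unique , (λ i → star (lookup B i) H) , (λ i → All.all-filter (lookup B i ∈?_) H) ,
  λ F → mk⇔ (λ F∈H → let F-meets = All.lookup covered F∈H in
                       Any.index F-meets , ∈-filter⁺ (_ ∈?_) F∈H (Any.lookup-index F-meets))
             (λ (i , F∈star) → proj₁ (∈-filter⁻ (lookup B i ∈?_) F∈star))

-- Arithmetic of the threshold

positive-numerator : ∀ {num d} .{cop : Coprime ℤ.∣ num ∣ (suc d)} → 0ℚ <ℚ mkℚ num d cop → ∃ λ p → num ≡ + suc p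
positive-numerator {+ suc p} _ = p , refl
positive-numerator {+ zero} (*<* (+<+ ()))
positive-numerator { -[1+ _ ]} (*<* ())

ℚᵘ-cross-multiply : ∀ a f p d N L →
  (mkℚᵘ (+ a) f +ᵘ mkℚᵘ (+ suc p) d) *ᵘ mkℚᵘ (+ N) 0 ≤ᵘ mkℚᵘ (+ L) 0 →
  (a * suc d + suc p * suc f) * N ≤ L * (suc f * suc d)
ℚᵘ-cross-multiply a f p d N L (*≤* le) = ℤ.drop‿+≤+ (subst₂ ℤ._≤_ lhs rhs le)
  where
  open ≡-Reasoning
  lhs : (+ a ℤ.* + suc d ℤ.+ + suc p ℤ.* + suc f) ℤ.* + N ℤ.* + 1 ≡ + ((a * suc d + suc p * suc f) * N)
  lhs = begin
    (+ a ℤ.* + suc d ℤ.+ + suc p ℤ.* + suc f) ℤ.* + N ℤ.* + 1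
      ≡⟨ ℤ.*-identityʳ _ ⟩
    (+ a ℤ.* + suc d ℤ.+ + suc p ℤ.* + suc f) ℤ.* + N
      ≡⟨ cong (ℤ._* + N) (cong₂ ℤ._+_ (ℤ.pos-* a (suc d)) (ℤ.pos-* (suc p) (suc f))) ⟨
    + (a * suc d + suc p * suc f) ℤ.* + N
      ≡⟨ ℤ.pos-* (a * suc d + suc p * suc f) N ⟨
    + ((a * suc d + suc p * suc f) * N) ∎
  rhs : + L ℤ.* + (suc f * suc d * 1) ≡ + (L * (suc f * suc d))
  rhs = trans (sym (ℤ.pos-* L _)) (cong (λ m → + (L * m)) (*-identityʳ _))

≤ℚ⇒cross-multiplied : ∀ a f .{{_ : NonZero f}} p d .(cop : Coprime (suc p) (suc d)) N L →
  ((+ a / f) +ℚ mkℚ (+ suc p) d cop) *ℚ (+ N / 1) ≤ℚ + L / 1 →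
  (a * suc d + suc p * f) * N ≤ L * (f * suc d)
≤ℚ⇒cross-multiplied a (suc f) p d cop N L le = ℚᵘ-cross-multiply a f p d N L
  (ℚᵘ.≤-respʳ-≃ (toℚᵘ-fromℚᵘ (mkℚᵘ (+ L) 0)) (ℚᵘ.≤-respˡ-≃ toℚᵘ-lhs (toℚᵘ-mono-≤ le)))
  where
  ε = mkℚ (+ suc p) d cop
  toℚᵘ-lhs : toℚᵘ (((+ a / suc f) +ℚ ε) *ℚ (+ N / 1)) ≃ᵘ (mkℚᵘ (+ a) f +ᵘ mkℚᵘ (+ suc p) d) *ᵘ mkℚᵘ (+ N) 0
  toℚᵘ-lhs = ℚᵘ.≃-trans (toℚᵘ-homo-* ((+ a / suc f) +ℚ ε) (+ N / 1))
    (ℚᵘ.*-cong (ℚᵘ.≃-trans (toℚᵘ-homo-+ (+ a / suc f) ε) (ℚᵘ.+-cong (toℚᵘ-fromℚᵘ (mkℚᵘ (+ a) f)) ℚᵘ.≃-refl))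
               (toℚᵘ-fromℚᵘ (mkℚᵘ (+ N) 0)))

cancel-leading-term : ∀ a D pp f N L Q → (a * D + pp * f) * N ≤ L * (f * D) → f * L ≤ a * N + f * Q →
  pp * f * N ≤ D * (f * Q)
cancel-leading-term a D pp f N L Q threshold≤ upper = +-cancelˡ-≤ (a * D * N) _ _ (begin
    a * D * N + pp * f * N   ≡⟨ solve 5 (λ a D pp f N → a :* D :* N :+ pp :* f :* N := (a :* D :+ pp :* f) :* N) refl a D pp f N ⟩
    (a * D + pp * f) * N     ≤⟨ threshold≤ ⟩
    L * (f * D)              ≡⟨ solve 3 (λ L f D → L :* (f :* D) := D :* (f :* L)) refl L f D ⟩
    D * (f * L)              ≤⟨ *-monoʳ-≤ D upper ⟩
    D * (a * N + f * Q)      ≡⟨ solve 5 (λ a D f N Q → D :* (a :* N :+ f :* Q) := a :* D :* N :+ D :* (f :* Q)) refl a D f N Q ⟩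
    a * D * N + D * (f * Q)  ∎)
  where open ≤-Reasoning; open +-*-Solver

*-codegreeBound<^ : ∀ k1 {X n} → X < n → X * codegreeBound k1 n < n ^ k1
*-codegreeBound<^ zero {X} _ = subst (_< 1) (sym (*-zeroʳ X)) (s≤s z≤n)
*-codegreeBound<^ (suc j) {n = suc m} X<n = *-monoˡ-< (suc m ^ j) {{m^n≢0 (suc m) j}} X<n

above-threshold⇒dense : ∀ k1 s1 p d .(cop : Coprime (suc p) (suc d)) C n L → suc d * (k1 ! * C) < n →
  threshold (suc k1) (suc s1) (mkℚ (+ suc p) d cop) n ≤ℚ + L / 1 →
  s1 * n ^ k1 + k1 ! * (C * codegreeBound k1 n) < k1 ! * L
above-threshold⇒dense k1 s1 p d cop C n L n-large threshold≤L = ≰⇒> λ sparse → <⇒≱ (begin-strict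
    suc d * (f * (C * P))  ≡⟨ solve 4 (λ D f C P → D :* (f :* (C :* P)) := D :* (f :* C) :* P) refl (suc d) f C P ⟩
    suc d * (f * C) * P    <⟨ *-codegreeBound<^ k1 n-large ⟩
    N                      ≡⟨ *-identityˡ N ⟨
    1 * N                  ≤⟨ *-monoˡ-≤ N (*-mono-≤ (s≤s (z≤n {p})) (1≤n! k1)) ⟩
    suc p * f * N          ∎)
  (cancel-leading-term s1 (suc d) (suc p) f N L (C * P) (≤ℚ⇒cross-multiplied s1 f {{k1 !≢0}} p d cop N L threshold≤L) sparse)
  where
  open ≤-Reasoning; open +-*-Solver
  f = k1 !
  N = n ^ k1
  P = codegreeBound k1 n

lemma2p3 : (k s : ℕ) → 1 ≤ k → 1 ≤ s →
    (ε : ℚ) → 0ℚ <ℚ ε →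
    ∃ λ n₀ → (n : ℕ) → n₀ ≤ n →
      (H : List (Subset n)) → Unique H → KUniform k H →
      MatchingNumberAtMost H s →
      threshold k s ε n ≤ℚ (+ length H / 1) →
      UnionOfTrivialIntersecting s H
lemma2p3 (suc k1) (suc s1) _ _ (mkℚ _ d cop) 0<ε with positive-numerator 0<ε
... | p , refl = suc (suc d * (k1 ! * C)) , λ n n₀≤n H H-unique uniform ν≤s threshold≤H →
  let open BigVertices H H-unique uniform ν≤s
      dense = above-threshold⇒dense k1 s1 p d cop C n (length H) n₀≤n threshold≤H
      |B|≡s = ≤-antisym length-B≤s (≮⇒≥ (λ |B|<s → <⇒≱ dense (length-B<s⇒sparse |B|<s)))
  in subst (λ s → UnionOfTrivialIntersecting s H) |B|≡s
       (covered⇒UnionOfTrivialIntersecting H B-unique (length-B≡s⇒covered |B|≡s))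
  where
  C = suc s1 * suc k1 * budget k1 s1
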